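{- Let $N$ be a $2$-XOR circulant network of size $n=2^p$, $p\in\mathbb{N}^*$, with interaction-step $s$ (arbitrary), updated in parallel. Every configuration $x\in\{0,1\}^n$ of repetition degree $\delta_r(x)\ge\log_2(n)-1$ converges towards $(0,\ldots,0)$ in no more than $2$ time steps, i.e. $F^2(x)=(0,\ldots,0)$, where $F$ is the global transition function.
   Context: A $2$-XOR circulant network of size $n\ge 2$ has automata $V=\{0,\ldots,n-1\}$, configurations $x\in\{0,1\}^n$, a circulant interaction matrix $\mathcal{C}$ ($\mathcal{C}_{i,j}=1$ iff automaton $j$ influences automaton $i$; $\mathcal{C}_{i,j}=c_{(j-i)\bmod n}$) with exactly two ones per row and $c_{n-1}=1$, local functions $f_i(x)=\sum_j\mathcal{C}_{i,j}x_j\bmod 2$, and parallel global transition function $F(x)=\mathcal{C}x\bmod 2$. The interaction-step is the smallest integer $s\neq1$, $0\le s<n$, such that automaton $i$ influences automaton $(i+s)\bmod n$ for every $i$ (so automaton $i$ is influenced exactly by $i-1$ and $i-s$ modulo $n$). For $n=2^p$, write $x=(x',x'')$ with $x'=(x_0,\ldots,x_{n/2-1})$, $x''=(x_{n/2},\ldots,x_{n-1})$; the repetition degree is defined recursively by $\delta_r(x)=0$ if $x'\neq x''$, and $\delta_r(x)=\delta_r(x')+1$ if $x'=x''$, with vectors of length $1$ having repetition degree $0$. -}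

module Defs where

open import Data.Bool using (Bool; true; false; _xor_; _∧_)
open import Data.Nat using (ℕ; zero; suc; _+_; _∸_; _^_; NonZero)
open import Data.Nat.DivMod using (_%_; m%n<n)
open import Data.Nat.Properties using (+-identityʳ)
open import Data.Fin using (Fin; toℕ; fromℕ<)
open import Data.Vec using (Vec; lookup; tabulate; foldr; take; drop; cast; countᵇ)
open import Data.Vec.Properties using (≡-dec)
open import Data.Bool.Properties using () renaming (_≟_ to _≟ᵇ_)
open import Relation.Binary.PropositionalEquality using (_≡_)
open import Relation.Nullary using (yes; no)
open import Function using (id)

xorSum : ∀ {n} → Vec Bool n → Bool
xorSum = foldr _ _xor_ false

subMod : ∀ {n} .{{_ : NonZero n}} → Fin n → Fin n → Fin n
subMod {n} j i = fromℕ< (m%n<n (toℕ j + (n ∸ toℕ i)) n)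

-- Circulant interaction matrix given by its first row c = (c_0, …, c_{n-1}):
-- C_{i,j} = c_{(j - i) mod n}.
circ : ∀ {n} .{{_ : NonZero n}} → Vec Bool n → Fin n → Fin n → Bool
circ c i j = lookup c (subMod j i)

Is2XORCirculant : ∀ {n} → Vec Bool n → Set
Is2XORCirculant {n} c =
  (countᵇ id c ≡ 2) × (∀ (k : Fin n) → toℕ k ≡ n ∸ 1 → lookup c k ≡ true)
  where open import Data.Product using (_×_)

globalF : ∀ {n} .{{_ : NonZero n}} → Vec Bool n → Vec Bool n → Vec Bool n
globalF c x = tabulate λ i → xorSum (tabulate λ j → circ c i j ∧ lookup x j)

firstHalf : ∀ p → Vec Bool (2 ^ suc p) → Vec Bool (2 ^ p)
firstHalf p x = take (2 ^ p) x

secondHalf : ∀ p → Vec Bool (2 ^ suc p) → Vec Bool (2 ^ p)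
secondHalf p x = cast (+-identityʳ (2 ^ p)) (drop (2 ^ p) x)

repDeg : ∀ p → Vec Bool (2 ^ p) → ℕ
repDeg zero    x = 0
repDeg (suc p) x with ≡-dec _≟ᵇ_ (firstHalf p x) (secondHalf p x)
... | yes _ = suc (repDeg p (firstHalf p x))
... | no  _ = 0

-- A configuration of repetition degree at least log₂ n − 1 is 2-periodic: x_j = g (parity of j)
-- for some g. Writing F(x)_i = x_{i+a} ⊕ x_{i+b} for the two ones a, b of the first row, a
-- 2-periodic x gives F(x)_i = g(i+a) ⊕ g(i+b) = [a+b odd] ∧ (g 0 ⊕ g 1); since n is even the
-- parity of i+a (mod n) is that of i+a, so this does not depend on i. Hence F(x) is constant,
-- and F of a constant configuration is 0 because every row has exactly two ones.
module Submission where

open import Defs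
open import Data.Bool using (Bool; true; false; not; _xor_; _∧_; if_then_else_)
open import Data.Bool.Properties
  using (xor-same; xor-comm; xor-identityʳ; not-involutive; not-distribˡ-xor) renaming (_≟_ to _≟ᵇ_)
open import Data.Nat using (ℕ; zero; suc; pred; _+_; _*_; _∸_; _^_; _<_; _≤_; NonZero; s≤s⁻¹)
open import Data.Nat.Properties using (m^n≢0; +-comm; +-assoc; +-identityʳ; m+[n∸m]≡n; <⇒≤)
open import Data.Nat.DivMod
  using (_%_; _/_; m%n<n; m≡m%n+[m/n]*n; m%n%n≡m%n; %-distribˡ-+; [m+n]%n≡m%n; m<n⇒m%n≡m)
open import Data.Nat.Divisibility using (_∣_; divides; m∣m*n; ∣n⇒∣m*n)
open import Data.Fin using (Fin; toℕ; fromℕ<; splitAt; _↑ˡ_; _↑ʳ_) renaming (zero to fz; suc to fs)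
open import Data.Fin.Properties
  using (toℕ-injective; toℕ-fromℕ<; toℕ<n; toℕ-cast; toℕ-↑ˡ; toℕ-↑ʳ; splitAt⁻¹-↑ˡ; splitAt⁻¹-↑ʳ; suc-injective)
import Data.Fin as Fin
open import Data.Vec using (Vec; []; _∷_; _++_; lookup; tabulate; replicate; take; drop; cast; countᵇ)
open import Data.Vec.Properties
  using (lookup∘tabulate; lookup-replicate; lookup-++ˡ; lookup-++ʳ; lookup-cast; take++drop≡id; ≡-dec)
open import Data.Product using (∃-syntax; _×_; _,_)
open import Data.Sum using (inj₁; inj₂)
open import Data.Empty using (⊥-elim)
open import Relation.Binary.PropositionalEquality
  using (_≡_; _≢_; refl; sym; trans; cong; cong₂; subst; module ≡-Reasoning)
open import Relation.Nullary using (yes; no)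
open import Function using (id; _∘_)

open ≡-Reasoning

xor-images : ∀ (g : Bool → Bool) u v → g u xor g v ≡ (u xor v) ∧ (g false xor g true)
xor-images g false false = xor-same (g false)
xor-images g false true  = refl
xor-images g true  false = xor-comm (g true) (g false)
xor-images g true  true  = xor-same (g true)

xor-cancel-shared : ∀ x y z → (x xor y) xor (x xor z) ≡ y xor z
xor-cancel-shared false y     z = refl
xor-cancel-shared true  true  z = refl
xor-cancel-shared true  false z = not-involutive z

odd : ℕ → Bool
odd zero    = false
odd (suc n) = not (odd n)

odd-+ : ∀ m n → odd (m + n) ≡ odd m xor odd n
odd-+ zero    n = refl
odd-+ (suc m) n = trans (cong not (odd-+ m n)) (not-distribˡ-xor (odd m) (odd n))

odd-*2 : ∀ m → odd (m * 2) ≡ false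
odd-*2 zero    = refl
odd-*2 (suc m) = trans (not-involutive (odd (m * 2))) (odd-*2 m)

even⇒¬odd : ∀ {m} → 2 ∣ m → odd m ≡ false
even⇒¬odd (divides q refl) = odd-*2 q

odd-even+ : ∀ {m} → 2 ∣ m → ∀ n → odd (m + n) ≡ odd n
odd-even+ {m} 2∣m n = trans (odd-+ m n) (cong (_xor odd n) (even⇒¬odd 2∣m))

odd-% : ∀ {n} .{{_ : NonZero n}} → 2 ∣ n → ∀ m → odd (m % n) ≡ odd m
odd-% {n} 2∣n m = sym (begin
  odd m                         ≡⟨ cong odd (m≡m%n+[m/n]*n m n) ⟩
  odd (m % n + (m / n) * n)     ≡⟨ cong odd (+-comm (m % n) _) ⟩
  odd ((m / n) * n + m % n)     ≡⟨ odd-even+ (∣n⇒∣m*n (m / n) 2∣n) (m % n) ⟩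
  odd (m % n)                   ∎)

[m%n+k]%n≡[m+k]%n : ∀ m k n .{{_ : NonZero n}} → (m % n + k) % n ≡ (m + k) % n
[m%n+k]%n≡[m+k]%n m k n = begin
  (m % n + k) % n          ≡⟨ %-distribˡ-+ (m % n) k n ⟩
  (m % n % n + k % n) % n  ≡⟨ cong (λ t → (t + k % n) % n) (m%n%n≡m%n m n) ⟩
  (m % n + k % n) % n      ≡⟨ %-distribˡ-+ m k n ⟨
  (m + k) % n              ∎

[m+k%n]%n≡[m+k]%n : ∀ m k n .{{_ : NonZero n}} → (m + k % n) % n ≡ (m + k) % n
[m+k%n]%n≡[m+k]%n m k n = begin
  (m + k % n) % n  ≡⟨ cong (_% n) (+-comm m (k % n)) ⟩
  (k % n + m) % n  ≡⟨ [m%n+k]%n≡[m+k]%n k m n ⟩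
  (k + m) % n      ≡⟨ cong (_% n) (+-comm k m) ⟩
  (m + k) % n      ∎

[i+m+[n∸i]]%n≡m : ∀ {n} .{{_ : NonZero n}} {i m} → i < n → m < n → (i + m + (n ∸ i)) % n ≡ m
[i+m+[n∸i]]%n≡m {n} {i} {m} i<n m<n = begin
  (i + m + (n ∸ i)) % n  ≡⟨ cong (λ t → (t + (n ∸ i)) % n) (+-comm i m) ⟩
  (m + i + (n ∸ i)) % n  ≡⟨ cong (_% n) (+-assoc m i (n ∸ i)) ⟩
  (m + (i + (n ∸ i))) % n ≡⟨ cong (λ t → (m + t) % n) (m+[n∸m]≡n (<⇒≤ i<n)) ⟩
  (m + n) % n            ≡⟨ [m+n]%n≡m%n m n ⟩
  m % n                  ≡⟨ m<n⇒m%n≡m m<n ⟩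
  m                      ∎

module _ {n} .{{_ : NonZero n}} where

  infixl 6 _⊕_

  _⊕_ : Fin n → Fin n → Fin n
  i ⊕ m = fromℕ< (m%n<n (toℕ i + toℕ m) n)

  subMod-⊕ : ∀ i m → subMod (i ⊕ m) i ≡ m
  subMod-⊕ i m = toℕ-injective (begin
    toℕ (subMod (i ⊕ m) i)                       ≡⟨ toℕ-fromℕ< _ ⟩
    (toℕ (i ⊕ m) + (n ∸ toℕ i)) % n              ≡⟨ cong (λ t → (t + (n ∸ toℕ i)) % n) (toℕ-fromℕ< _) ⟩
    ((toℕ i + toℕ m) % n + (n ∸ toℕ i)) % n      ≡⟨ [m%n+k]%n≡[m+k]%n (toℕ i + toℕ m) (n ∸ toℕ i) n ⟩
    (toℕ i + toℕ m + (n ∸ toℕ i)) % n            ≡⟨ [i+m+[n∸i]]%n≡m (toℕ<n i) (toℕ<n m) ⟩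
    toℕ m                                        ∎)

  ⊕-subMod : ∀ i j → i ⊕ subMod j i ≡ j
  ⊕-subMod i j = toℕ-injective (begin
    toℕ (i ⊕ subMod j i)                         ≡⟨ toℕ-fromℕ< _ ⟩
    (toℕ i + toℕ (subMod j i)) % n               ≡⟨ cong (λ t → (toℕ i + t) % n) (toℕ-fromℕ< _) ⟩
    (toℕ i + (toℕ j + (n ∸ toℕ i)) % n) % n      ≡⟨ [m+k%n]%n≡[m+k]%n (toℕ i) (toℕ j + (n ∸ toℕ i)) n ⟩
    (toℕ i + (toℕ j + (n ∸ toℕ i))) % n          ≡⟨ cong (_% n) (+-assoc (toℕ i) (toℕ j) _) ⟨
    (toℕ i + toℕ j + (n ∸ toℕ i)) % n            ≡⟨ [i+m+[n∸i]]%n≡m (toℕ<n i) (toℕ<n j) ⟩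
    toℕ j                                        ∎)

  ⊕-cancelˡ : ∀ i {m m′} → i ⊕ m ≡ i ⊕ m′ → m ≡ m′
  ⊕-cancelˡ i {m} {m′} eq = begin
    m                 ≡⟨ subMod-⊕ i m ⟨
    subMod (i ⊕ m) i  ≡⟨ cong (λ j → subMod j i) eq ⟩
    subMod (i ⊕ m′) i ≡⟨ subMod-⊕ i m′ ⟩
    m′                ∎

  odd-⊕ : 2 ∣ n → ∀ i m → odd (toℕ (i ⊕ m)) ≡ odd (toℕ i) xor odd (toℕ m)
  odd-⊕ 2∣n i m = begin
    odd (toℕ (i ⊕ m))            ≡⟨ cong odd (toℕ-fromℕ< (m%n<n (toℕ i + toℕ m) n)) ⟩
    odd ((toℕ i + toℕ m) % n)    ≡⟨ odd-% 2∣n (toℕ i + toℕ m) ⟩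
    odd (toℕ i + toℕ m)          ≡⟨ odd-+ (toℕ i) (toℕ m) ⟩
    odd (toℕ i) xor odd (toℕ m)  ∎

xorSum-tabulate-false : ∀ {n} (f : Fin n → Bool) → (∀ j → f j ≡ false) → xorSum (tabulate f) ≡ false
xorSum-tabulate-false {zero}  f f≡false = refl
xorSum-tabulate-false {suc n} f f≡false rewrite f≡false fz =
  xorSum-tabulate-false (f ∘ fs) (f≡false ∘ fs)

xorSum-tabulate-single : ∀ {n} (f : Fin n → Bool) a → (∀ j → j ≢ a → f j ≡ false) →
                         xorSum (tabulate f) ≡ f a
xorSum-tabulate-single f fz outside =
  trans (cong (f fz xor_) (xorSum-tabulate-false (f ∘ fs) (λ j → outside (fs j) λ ())))
        (xor-identityʳ (f fz))
xorSum-tabulate-single f (fs a) outside rewrite outside fz (λ ()) =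
  xorSum-tabulate-single (f ∘ fs) a (λ j j≢a → outside (fs j) (j≢a ∘ suc-injective))

xorSum-tabulate-pair : ∀ {n} (f : Fin n → Bool) a b → a ≢ b → (∀ j → j ≢ a → j ≢ b → f j ≡ false) →
                       xorSum (tabulate f) ≡ f a xor f b
xorSum-tabulate-pair f fz fz a≢b outside = ⊥-elim (a≢b refl)
xorSum-tabulate-pair f fz (fs b) a≢b outside =
  cong (f fz xor_) (xorSum-tabulate-single (f ∘ fs) b λ j j≢b → outside (fs j) (λ ()) (j≢b ∘ suc-injective))
xorSum-tabulate-pair f (fs a) fz a≢b outside =
  trans (cong (f fz xor_) (xorSum-tabulate-single (f ∘ fs) a λ j j≢a → outside (fs j) (j≢a ∘ suc-injective) (λ ())))
        (xor-comm (f fz) (f (fs a)))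
xorSum-tabulate-pair f (fs a) (fs b) a≢b outside rewrite outside fz (λ ()) (λ ()) =
  xorSum-tabulate-pair (f ∘ fs) a b (a≢b ∘ cong fs)
    (λ j j≢a j≢b → outside (fs j) (j≢a ∘ suc-injective) (j≢b ∘ suc-injective))

lookup-const⇒≡replicate : ∀ {A : Set} {n} (xs : Vec A n) {v} → (∀ i → lookup xs i ≡ v) → xs ≡ replicate n v
lookup-const⇒≡replicate []       _      = refl
lookup-const⇒≡replicate (x ∷ xs) x≡v = cong₂ _∷_ (x≡v fz) (lookup-const⇒≡replicate xs (x≡v ∘ fs))

record TwoOnes {n} (c : Vec Bool n) : Set where
  field
    a b    : Fin n
    a≢b    : a ≢ b
    c[a]   : lookup c a ≡ true
    c[b]   : lookup c b ≡ true
    others : ∀ j → j ≢ a → j ≢ b → lookup c j ≡ false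

countᵇ≡0⇒allFalse : ∀ {n} (c : Vec Bool n) → countᵇ id c ≡ 0 → ∀ j → lookup c j ≡ false
countᵇ≡0⇒allFalse (true  ∷ c) ()
countᵇ≡0⇒allFalse (false ∷ c) none fz     = refl
countᵇ≡0⇒allFalse (false ∷ c) none (fs j) = countᵇ≡0⇒allFalse c none j

countᵇ≡1⇒single : ∀ {n} (c : Vec Bool n) → countᵇ id c ≡ 1 →
                  ∃[ a ] lookup c a ≡ true × (∀ j → j ≢ a → lookup c j ≡ false)
countᵇ≡1⇒single (true ∷ c) one = fz , refl , others
  where
  others : ∀ j → j ≢ fz → lookup (true ∷ c) j ≡ false
  others fz     j≢a = ⊥-elim (j≢a refl)
  others (fs j) _   = countᵇ≡0⇒allFalse c (cong pred one) j
countᵇ≡1⇒single (false ∷ c) one with countᵇ≡1⇒single c one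
... | a , c[a] , others = fs a , c[a] , others′
  where
  others′ : ∀ j → j ≢ fs a → lookup (false ∷ c) j ≡ false
  others′ fz     _   = refl
  others′ (fs j) j≢a = others j (j≢a ∘ cong fs)

countᵇ≡2⇒twoOnes : ∀ {n} (c : Vec Bool n) → countᵇ id c ≡ 2 → TwoOnes c
countᵇ≡2⇒twoOnes (true ∷ c) two with countᵇ≡1⇒single c (cong pred two)
... | b , c[b] , others = record
  { a = fz ; b = fs b ; a≢b = λ () ; c[a] = refl ; c[b] = c[b] ; others = others′ }
  where
  others′ : ∀ j → j ≢ fz → j ≢ fs b → lookup (true ∷ c) j ≡ false
  others′ fz     j≢a _   = ⊥-elim (j≢a refl)
  others′ (fs j) _   j≢b = others j (j≢b ∘ cong fs)
countᵇ≡2⇒twoOnes (false ∷ c) two = record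
  { a = fs a ; b = fs b ; a≢b = a≢b ∘ suc-injective ; c[a] = c[a] ; c[b] = c[b] ; others = others′ }
  where
  open TwoOnes (countᵇ≡2⇒twoOnes c two)
  others′ : ∀ j → j ≢ fs a → j ≢ fs b → lookup (false ∷ c) j ≡ false
  others′ fz     _   _   = refl
  others′ (fs j) j≢a j≢b = others j (j≢a ∘ cong fs) (j≢b ∘ cong fs)

FollowsParity : ∀ {n} → (Bool → Bool) → Vec Bool n → Set
FollowsParity g y = ∀ j → lookup y j ≡ g (odd (toℕ j))

++-followsParity : ∀ {m k g} (ys : Vec Bool m) (zs : Vec Bool k) → 2 ∣ m →
                   FollowsParity g ys → FollowsParity g zs → FollowsParity g (ys ++ zs)
++-followsParity {m} {k} {g} ys zs 2∣m ys~g zs~g j with splitAt m j in split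
... | inj₁ i = subst (λ j → lookup (ys ++ zs) j ≡ g (odd (toℕ j))) (splitAt⁻¹-↑ˡ split) (begin
  lookup (ys ++ zs) (i ↑ˡ k) ≡⟨ lookup-++ˡ ys zs i ⟩
  lookup ys i                ≡⟨ ys~g i ⟩
  g (odd (toℕ i))            ≡⟨ cong (g ∘ odd) (toℕ-↑ˡ i k) ⟨
  g (odd (toℕ (i ↑ˡ k)))     ∎)
... | inj₂ i = subst (λ j → lookup (ys ++ zs) j ≡ g (odd (toℕ j))) (splitAt⁻¹-↑ʳ split) (begin
  lookup (ys ++ zs) (m ↑ʳ i) ≡⟨ lookup-++ʳ ys zs i ⟩
  lookup zs i                ≡⟨ zs~g i ⟩
  g (odd (toℕ i))            ≡⟨ cong g (odd-even+ 2∣m (toℕ i)) ⟨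
  g (odd (m + toℕ i))        ≡⟨ cong (g ∘ odd) (toℕ-↑ʳ m i) ⟨
  g (odd (toℕ (m ↑ʳ i)))     ∎)

cast-followsParity⁻ : ∀ {m k g} .(eq : m ≡ k) (zs : Vec Bool m) →
                      FollowsParity g (cast eq zs) → FollowsParity g zs
cast-followsParity⁻ {g = g} eq zs cast~g j = begin
  lookup zs j                      ≡⟨ lookup-cast eq zs j ⟨
  lookup (cast eq zs) (Fin.cast eq j) ≡⟨ cast~g (Fin.cast eq j) ⟩
  g (odd (toℕ (Fin.cast eq j)))    ≡⟨ cong (g ∘ odd) (toℕ-cast eq j) ⟩
  g (odd (toℕ j))                  ∎

repDeg-followsParity : ∀ q (x : Vec Bool (2 ^ suc q)) → q ≤ repDeg (suc q) x → ∃[ g ] FollowsParity g x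
repDeg-followsParity zero (u ∷ v ∷ []) _ = (λ b → if b then v else u) , λ { fz → refl ; (fs fz) → refl }
repDeg-followsParity (suc q) x deg
  with ≡-dec _≟ᵇ_ (firstHalf (suc q) x) (secondHalf (suc q) x)
... | no _ with () ← deg
... | yes halves≡ with repDeg-followsParity q (firstHalf (suc q) x) (s≤s⁻¹ deg)
...   | g , first~g = g , subst (FollowsParity g) (take++drop≡id h x)
          (++-followsParity {g = g} (take h x) (drop h x) (m∣m*n (2 ^ q)) first~g
            (cast-followsParity⁻ {g = g} (+-identityʳ h) (drop h x) (subst (FollowsParity g) halves≡ first~g)))
  where h = 2 ^ suc q

module TwoXORNetwork {n} .{{_ : NonZero n}} (c : Vec Bool n) (ones : TwoOnes c) where
  open TwoOnes ones

  globalF-lookup : ∀ y i → lookup (globalF c y) i ≡ lookup y (i ⊕ a) xor lookup y (i ⊕ b)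
  globalF-lookup y i = begin
    lookup (globalF c y) i                    ≡⟨ lookup∘tabulate _ i ⟩
    xorSum (tabulate f)                       ≡⟨ xorSum-tabulate-pair f (i ⊕ a) (i ⊕ b) (a≢b ∘ ⊕-cancelˡ i) outside ⟩
    f (i ⊕ a) xor f (i ⊕ b)                   ≡⟨ cong₂ _xor_ (at-one a c[a]) (at-one b c[b]) ⟩
    lookup y (i ⊕ a) xor lookup y (i ⊕ b)     ∎
    where
    f : Fin n → Bool
    f j = circ c i j ∧ lookup y j

    at-one : ∀ m → lookup c m ≡ true → f (i ⊕ m) ≡ lookup y (i ⊕ m)
    at-one m c[m] rewrite subMod-⊕ i m | c[m] = refl

    outside : ∀ j → j ≢ i ⊕ a → j ≢ i ⊕ b → f j ≡ false
    outside j j≢a j≢b = cong (_∧ lookup y j) (others (subMod j i) (shifted j≢a) (shifted j≢b))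
      where
      shifted : ∀ {m} → j ≢ i ⊕ m → subMod j i ≢ m
      shifted j≢ eq = j≢ (trans (sym (⊕-subMod i j)) (cong (i ⊕_) eq))

  globalF-replicate : ∀ v → globalF c (replicate n v) ≡ replicate n false
  globalF-replicate v = lookup-const⇒≡replicate _ λ i → begin
    lookup (globalF c vs) i                ≡⟨ globalF-lookup vs i ⟩
    lookup vs (i ⊕ a) xor lookup vs (i ⊕ b) ≡⟨ cong₂ _xor_ (lookup-replicate (i ⊕ a) v) (lookup-replicate (i ⊕ b) v) ⟩
    v xor v                                ≡⟨ xor-same v ⟩
    false                                  ∎
    where
    vs : Vec Bool n
    vs = replicate n v

  module _ (2∣n : 2 ∣ n) where

    globalF-followsParity : ∀ {g y} → FollowsParity g y →
                            globalF c y ≡ replicate n ((odd (toℕ a) xor odd (toℕ b)) ∧ (g false xor g true))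
    globalF-followsParity {g} {y} y~g = lookup-const⇒≡replicate _ λ i → begin
      lookup (globalF c y) i                      ≡⟨ globalF-lookup y i ⟩
      lookup y (i ⊕ a) xor lookup y (i ⊕ b)       ≡⟨ cong₂ _xor_ (y~g (i ⊕ a)) (y~g (i ⊕ b)) ⟩
      g (π (i ⊕ a)) xor g (π (i ⊕ b))             ≡⟨ xor-images g _ _ ⟩
      (π (i ⊕ a) xor π (i ⊕ b)) ∧ β               ≡⟨ cong (_∧ β) (cong₂ _xor_ (odd-⊕ 2∣n i a) (odd-⊕ 2∣n i b)) ⟩
      ((π i xor π a) xor (π i xor π b)) ∧ β       ≡⟨ cong (_∧ β) (xor-cancel-shared (π i) (π a) (π b)) ⟩
      (π a xor π b) ∧ β                           ∎
      where
      π : Fin n → Bool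
      π j = odd (toℕ j)
      β : Bool
      β = g false xor g true

    globalF²-followsParity : ∀ {g y} → FollowsParity g y → globalF c (globalF c y) ≡ replicate n false
    globalF²-followsParity {g} {y} y~g =
      trans (cong (globalF c) (globalF-followsParity {g} {y} y~g)) (globalF-replicate _)

proposition5 : (p : ℕ) → 1 ≤ p → (c : Vec Bool (2 ^ p)) → Is2XORCirculant c →
    (x : Vec Bool (2 ^ p)) → p ∸ 1 ≤ repDeg p x →
    globalF {{m^n≢0 2 p}} c (globalF {{m^n≢0 2 p}} c x) ≡ replicate (2 ^ p) false
proposition5 zero    ()
proposition5 (suc q) _ c (two-ones , _) x deg with repDeg-followsParity q x deg
... | g , x~g = TwoXORNetwork.globalF²-followsParity {{m^n≢0 2 (suc q)}}
                  c (countᵇ≡2⇒twoOnes c two-ones) (m∣m*n (2 ^ q)) {g} {x} x~g
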